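{- Let $G$ be a finite simple graph and let $K_{m_1,m_2}$ be the complete bipartite graph with parts $A_1$ (of size $m_1$) and $A_2$ (of size $m_2$). For any minor embedding of $G$ in $K_{m_1,m_2}$, let $S \subseteq V(G)$ be the set of vertices of $G$ whose branch set contains vertices of both parts $A_1$ and $A_2$. Then there is an odd cycle transversal $T$ of $G$ with $T \subseteq S$. Moreover, there exist cases (a graph $G$ and integers $m_1,m_2$ such that $G$ has a minor embedding in $K_{m_1,m_2}$) in which, for every possible minor embedding of $G$ in $K_{m_1,m_2}$, the corresponding set $S$ properly contains an odd cycle transversal $T$ of $G$, i.e. $T \subsetneq S$.
   Context: A minor embedding of a graph $G$ in a graph $H$ assigns to each vertex $v \in V(G)$ a nonempty set $U_v \subseteq V(H)$ (its branch set) such that the sets $U_v$ are pairwise disjoint, the subgraph of $H$ induced on each $U_v$ is connected, and for each edge $\{v,w\} \in E(G)$ there exist $u \in U_v$ and $u' \in U_w$ with $\{u,u'\} \in E(H)$. A vertex of $G$ is said to be assigned to a part of $K_{m_1,m_2}$ if its branch set contains a vertex of that part. An odd cycle transversal (OCT) of $G$ is a set $T \subseteq V(G)$ such that every odd cycle of $G$ contains at least one vertex of $T$ (equivalently, $G - T$ is bipartite). -}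

module Defs where

open import Data.Nat using (ℕ; zero; suc; _+_; _*_)
open import Data.Fin using (Fin; zero; suc; inject₁; fromℕ)
open import Data.Bool using (Bool; true; false)
open import Data.Sum using (_⊎_; inj₁; inj₂)
open import Data.Product using (Σ; ∃; ∃-syntax; _×_; _,_)
open import Relation.Binary.PropositionalEquality using (_≡_)
open import Relation.Nullary using (¬_)
open import Data.Empty using (⊥)
open import Function.Definitions using (Injective)

record Graph (V : Set) : Set where
  field
    adj   : V → V → Bool
    sym   : ∀ x y → adj x y ≡ adj y x
    irref : ∀ x → adj x x ≡ false
open Graph public

-- Complete bipartite graph K_{m1,m2}: parts A1 = inj₁ (Fin m1), A2 = inj₂ (Fin m2).
KAdj : (m₁ m₂ : ℕ) → Fin m₁ ⊎ Fin m₂ → Fin m₁ ⊎ Fin m₂ → Bool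
KAdj m₁ m₂ (inj₁ _) (inj₁ _) = false
KAdj m₁ m₂ (inj₁ _) (inj₂ _) = true
KAdj m₁ m₂ (inj₂ _) (inj₁ _) = true
KAdj m₁ m₂ (inj₂ _) (inj₂ _) = false

K : (m₁ m₂ : ℕ) → Graph (Fin m₁ ⊎ Fin m₂)
K m₁ m₂ = record { adj = KAdj m₁ m₂ ; sym = s ; irref = i }
  where
  s : ∀ x y → KAdj m₁ m₂ x y ≡ KAdj m₁ m₂ y x
  s (inj₁ _) (inj₁ _) = _≡_.refl
  s (inj₁ _) (inj₂ _) = _≡_.refl
  s (inj₂ _) (inj₁ _) = _≡_.refl
  s (inj₂ _) (inj₂ _) = _≡_.refl
  i : ∀ x → KAdj m₁ m₂ x x ≡ false
  i (inj₁ _) = _≡_.refl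
  i (inj₂ _) = _≡_.refl

Subset : Set → Set
Subset V = V → Bool

_∈ₛ_ : ∀ {V} → V → Subset V → Set
x ∈ₛ U = U x ≡ true

data WalkIn {V : Set} (H : Graph V) (U : Subset V) : V → V → Set where
  here : ∀ {x} → x ∈ₛ U → WalkIn H U x x
  step : ∀ {x z y} → x ∈ₛ U → adj H x z ≡ true → WalkIn H U z y → WalkIn H U x y

Connected : ∀ {V} → Graph V → Subset V → Set
Connected H U = ∀ x y → x ∈ₛ U → y ∈ₛ U → WalkIn H U x y

record MinorEmbedding {VG VH : Set} (G : Graph VG) (H : Graph VH) : Set where
  field
    branch    : VG → Subset VH
    nonempty  : ∀ v → ∃[ u ] (u ∈ₛ branch v)
    disjoint  : ∀ v w u → ¬ (v ≡ w) → u ∈ₛ branch v → u ∈ₛ branch w → ⊥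
    connected : ∀ v → Connected H (branch v)
    edges     : ∀ v w → adj G v w ≡ true →
                ∃[ u ] ∃[ u' ] (u ∈ₛ branch v × u' ∈ₛ branch w × adj H u u' ≡ true)
open MinorEmbedding public

InBoth : ∀ {n m₁ m₂} {G : Graph (Fin n)} → MinorEmbedding G (K m₁ m₂) → Fin n → Set
InBoth {m₁ = m₁} {m₂} e v =
  (∃[ a ] (inj₁ a ∈ₛ branch e v)) × (∃[ b ] (inj₂ b ∈ₛ branch e v))

-- An odd cycle of G: distinct vertices c 0, …, c (2j+2) (length 2j+3 ≥ 3, odd),
-- consecutive ones adjacent and the last adjacent to the first.
record OddCycle {n : ℕ} (G : Graph (Fin n)) : Set where
  field
    j       : ℕ
    vtx     : Fin (suc (suc (suc (2 * j)))) → Fin n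
    inj     : Injective _≡_ _≡_ vtx
    consec  : ∀ (i : Fin (suc (suc (2 * j)))) → adj G (vtx (inject₁ i)) (vtx (suc i)) ≡ true
    closing : adj G (vtx (fromℕ (suc (suc (2 * j))))) (vtx zero) ≡ true
open OddCycle public

IsOCT : ∀ {n} → Graph (Fin n) → Subset (Fin n) → Set
IsOCT G T = (C : OddCycle G) → ∃[ i ] (vtx C i ∈ₛ T)

-- Each vertex outside S has its branch set inside one part of K_{m₁,m₂}, and since
-- K_{m₁,m₂} has no edges within a part, adjacent vertices outside S lie in different
-- parts. Colouring a vertex by whether its branch set meets A₁ is therefore a proper
-- 2-colouring of G − S, so S is an odd cycle transversal.
-- For strictness take the star K_{1,4} in K_{3,3}: it is bipartite, so ∅ is an odd
-- cycle transversal, while the centre lies in S for every embedding, because a centre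
-- confined to one part forces its four leaves into four disjoint branch sets that all
-- meet the other part, which has only three vertices.
module Submission where

open import Defs
open import Data.Nat using (ℕ; zero; suc; _*_; _<_)
open import Data.Nat.GeneralisedArithmetic using (iterate)
open import Data.Nat.Properties using (*-suc; n<1+n)
open import Data.Fin using (Fin; zero; suc; inject₁; fromℕ) renaming (_≟_ to _≟ᶠ_)
open import Data.Fin.Properties using (any?; all?; pigeonhole; <⇒≢; suc-injective)
open import Data.Bool using (Bool; true; false; not)
open import Data.Bool.Properties using (not-involutive; not-¬) renaming (_≟_ to _≟ᵇ_)
open import Data.Sum using (_⊎_; inj₁; inj₂; [_,_])
open import Data.Sum.Properties using (≡-dec)
open import Data.Product using (_×_; ∃-syntax; _,_; proj₁; proj₂)
open import Data.Empty using (⊥-elim)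
open import Function using (_∘_)
open import Function.Definitions using (Injective)
open import Relation.Binary.Definitions using (DecidableEquality)
open import Relation.Nullary using (¬_; Dec; does; yes; no)
open import Relation.Nullary.Decidable
  using (map′; _×-dec_; _⊎-dec_; _→-dec_; dec-true; dec-false; decidable-stable; from-yes)
open import Relation.Binary.PropositionalEquality as ≡ using (_≡_; refl; trans; cong; subst)

does-true⇒ : ∀ {A : Set} (a? : Dec A) → does a? ≡ true → A
does-true⇒ (yes a) _ = a

iterate-not-even : ∀ c j → iterate not c (2 * j) ≡ c
iterate-not-even c zero = refl
iterate-not-even c (suc j) = begin
  iterate not c (2 * suc j)         ≡⟨ cong (iterate not c) (*-suc 2 j) ⟩
  iterate not (not (not c)) (2 * j) ≡⟨ cong (λ d → iterate not d (2 * j)) (not-involutive c) ⟩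
  iterate not c (2 * j)             ≡⟨ iterate-not-even c j ⟩
  c                                 ∎
  where open ≡.≡-Reasoning

Alternating : ∀ {k} → (Fin (suc k) → Bool) → Set
Alternating b = ∀ i → b (suc i) ≡ not (b (inject₁ i))

alternating-last : ∀ k (b : Fin (suc k) → Bool) → Alternating b →
                   b (fromℕ k) ≡ iterate not (b zero) k
alternating-last zero    b alt = refl
alternating-last (suc k) b alt =
  trans (alternating-last k (b ∘ suc) (alt ∘ suc)) (cong (λ c → iterate not c k) (alt zero))

ProperColouringOutside : ∀ {n} → Graph (Fin n) → Subset (Fin n) → (Fin n → Bool) → Set
ProperColouringOutside G T col =
  ∀ x y → adj G x y ≡ true → ¬ (x ∈ₛ T) → ¬ (y ∈ₛ T) → col y ≡ not (col x)

properColouringOutside⇒IsOCT : ∀ {n} {G : Graph (Fin n)} {T : Subset (Fin n)} (col : Fin n → Bool) →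
                               ProperColouringOutside G T col → IsOCT G T
properColouringOutside⇒IsOCT {T = T} col proper C with any? (λ i → T (vtx C i) ≟ᵇ true)
... | yes hit  = hit
... | no ¬hit = ⊥-elim (not-¬ (≡.sym colour-at-end) colour-at-start)
  where
  avoids : ∀ i → ¬ (vtx C i ∈ₛ T)
  avoids i t = ¬hit (i , t)

  last : Fin (suc (suc (suc (2 * j C))))
  last = fromℕ (suc (suc (2 * j C)))

  c₀ : Bool
  c₀ = col (vtx C zero)

  colour-at-start : c₀ ≡ not (col (vtx C last))
  colour-at-start = proper _ _ (closing C) (avoids _) (avoids _)

  colour-at-end : col (vtx C last) ≡ c₀
  colour-at-end =
    trans (alternating-last _ (col ∘ vtx C) (λ i → proper _ _ (consec C i) (avoids _) (avoids _)))
          (trans (iterate-not-even (not (not c₀)) (j C)) (not-involutive c₀))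

module _ {m₁ m₂ : ℕ} where

  Meets₁ Meets₂ : Subset (Fin m₁ ⊎ Fin m₂) → Set
  Meets₁ U = ∃[ a ] (inj₁ a ∈ₛ U)
  Meets₂ U = ∃[ b ] (inj₂ b ∈ₛ U)

  meets₁? : ∀ U → Dec (Meets₁ U)
  meets₁? U = any? (λ a → U (inj₁ a) ≟ᵇ true)

  meets₂? : ∀ U → Dec (Meets₂ U)
  meets₂? U = any? (λ b → U (inj₂ b) ≟ᵇ true)

  module _ {n : ℕ} {G : Graph (Fin n)} (e : MinorEmbedding G (K m₁ m₂)) where

    inBoth? : ∀ v → Dec (InBoth e v)
    inBoth? v = meets₁? (branch e v) ×-dec meets₂? (branch e v)

    spanning : Subset (Fin n)
    spanning v = does (inBoth? v)

    meetsA₁ : Fin n → Bool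
    meetsA₁ v = does (meets₁? (branch e v))

    meetsA₂-only : ∀ {v} → ¬ (v ∈ₛ spanning) → Meets₂ (branch e v) → meetsA₁ v ≡ false
    meetsA₂-only {v} v∉S v₂ =
      dec-false (meets₁? (branch e v)) (λ v₁ → v∉S (dec-true (inBoth? v) (v₁ , v₂)))

    meetsA₁-properOutsideSpanning : ProperColouringOutside G spanning meetsA₁
    meetsA₁-properOutsideSpanning x y xy x∉S y∉S with edges e x y xy
    ... | inj₁ a , inj₂ b , a∈x , b∈y , _ =
      trans (meetsA₂-only y∉S (b , b∈y)) (cong not (≡.sym (dec-true (meets₁? (branch e x)) (a , a∈x))))
    ... | inj₂ b , inj₁ a , b∈x , a∈y , _ =
      trans (dec-true (meets₁? (branch e y)) (a , a∈y)) (cong not (≡.sym (meetsA₂-only x∉S (b , b∈x))))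

    spanning-IsOCT : IsOCT G spanning
    spanning-IsOCT = properColouringOutside⇒IsOCT meetsA₁ meetsA₁-properOutsideSpanning

    spanning⊆InBoth : ∀ v → v ∈ₛ spanning → InBoth e v
    spanning⊆InBoth v = does-true⇒ (inBoth? v)

    misses₁⇒neighbour-meets₁ : ∀ {v w} → ¬ Meets₁ (branch e v) → adj G v w ≡ true →
                               Meets₁ (branch e w)
    misses₁⇒neighbour-meets₁ {v} {w} miss vw with edges e v w vw
    ... | inj₁ a , _      , a∈v , _   , _ = ⊥-elim (miss (a , a∈v))
    ... | inj₂ _ , inj₁ a , _   , a∈w , _ = a , a∈w

    misses₂⇒neighbour-meets₂ : ∀ {v w} → ¬ Meets₂ (branch e v) → adj G v w ≡ true →
                               Meets₂ (branch e w)
    misses₂⇒neighbour-meets₂ {v} {w} miss vw with edges e v w vw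
    ... | inj₂ b , _      , b∈v , _   , _ = ⊥-elim (miss (b , b∈v))
    ... | inj₁ _ , inj₂ b , _   , b∈w , _ = b , b∈w

disjointBranches-≮ : ∀ {VG VH} {G : Graph VG} {H : Graph VH} (e : MinorEmbedding G H) {k m}
                     (w : Fin k → VG) → Injective _≡_ _≡_ w → (ι : Fin m → VH) (r : Fin k → Fin m) →
                     (∀ i → ι (r i) ∈ₛ branch e (w i)) → ¬ (m < k)
disjointBranches-≮ e w w-inj ι r r∈ m<k with pigeonhole m<k r
... | i , j , i<j , rᵢ≡rⱼ =
  disjoint e (w i) (w j) (ι (r j)) (<⇒≢ i<j ∘ w-inj)
           (subst (λ x → ι x ∈ₛ branch e (w i)) rᵢ≡rⱼ (r∈ i)) (r∈ j)

clique⇒Connected : ∀ {V} {H : Graph V} {U : Subset V} →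
                   (∀ x y → x ∈ₛ U → y ∈ₛ U → x ≡ y ⊎ adj H x y ≡ true) → Connected H U
clique⇒Connected clique x y x∈U y∈U with clique x y x∈U y∈U
... | inj₁ refl = here x∈U
... | inj₂ xy   = step x∈U xy (here y∈U)

module _ {VG VH : Set} (_≟_ : DecidableEquality VG) (owner : VH → VG) where

  fibre : VG → Subset VH
  fibre v u = does (owner u ≟ v)

  ∈-fibre⇒owner : ∀ {u v} → u ∈ₛ fibre v → owner u ≡ v
  ∈-fibre⇒owner {u} {v} = does-true⇒ (owner u ≟ v)

  owner⇒∈-fibre : ∀ {u v} → owner u ≡ v → u ∈ₛ fibre v
  owner⇒∈-fibre {u} {v} = dec-true (owner u ≟ v)

  contraction : ∀ {G : Graph VG} {H : Graph VH} →
                (∀ v → ∃[ u ] owner u ≡ v) →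
                (∀ v → Connected H (fibre v)) →
                (∀ v w → adj G v w ≡ true →
                   ∃[ u ] ∃[ u' ] (owner u ≡ v × owner u' ≡ w × adj H u u' ≡ true)) →
                MinorEmbedding G H
  contraction surjective fibres-connected lifts-edges = record
    { branch    = fibre
    ; nonempty  = λ v → let u , uv = surjective v in u , owner⇒∈-fibre uv
    ; disjoint  = λ v w u v≢w u∈v u∈w →
                    v≢w (trans (≡.sym (∈-fibre⇒owner u∈v)) (∈-fibre⇒owner u∈w))
    ; connected = fibres-connected
    ; edges     = λ v w vw → let u , u' , uv , u'w , uu' = lifts-edges v w vw in
                    u , u' , owner⇒∈-fibre uv , owner⇒∈-fibre u'w , uu'
    }

all⊎? : ∀ {m n} {P : Fin m ⊎ Fin n → Set} → (∀ u → Dec (P u)) → Dec (∀ u → P u)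
all⊎? P? = map′ (λ (p , q) → [ p , q ]) (λ p → p ∘ inj₁ , p ∘ inj₂)
                (all? (P? ∘ inj₁) ×-dec all? (P? ∘ inj₂))

any⊎? : ∀ {m n} {P : Fin m ⊎ Fin n → Set} → (∀ u → Dec (P u)) → Dec (∃[ u ] P u)
any⊎? P? = map′ [ (λ (a , p) → inj₁ a , p) , (λ (b , p) → inj₂ b , p) ]
                (λ { (inj₁ a , p) → inj₁ (a , p) ; (inj₂ b , p) → inj₂ (b , p) })
                (any? (P? ∘ inj₁) ⊎-dec any? (P? ∘ inj₂))

starAdj : ∀ {k} → Fin (suc k) → Fin (suc k) → Bool
starAdj zero    zero    = false
starAdj zero    (suc _) = true
starAdj (suc _) zero    = true
starAdj (suc _) (suc _) = false

starAdj-sym : ∀ {k} (x y : Fin (suc k)) → starAdj x y ≡ starAdj y x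
starAdj-sym zero    zero    = refl
starAdj-sym zero    (suc _) = refl
starAdj-sym (suc _) zero    = refl
starAdj-sym (suc _) (suc _) = refl

starAdj-irrefl : ∀ {k} (x : Fin (suc k)) → starAdj x x ≡ false
starAdj-irrefl zero    = refl
starAdj-irrefl (suc _) = refl

Star : ∀ k → Graph (Fin (suc k))
Star k = record { adj = starAdj ; sym = starAdj-sym ; irref = starAdj-irrefl }

isCentre : ∀ {k} → Fin (suc k) → Bool
isCentre zero    = true
isCentre (suc _) = false

Star-IsOCT-∅ : ∀ k → IsOCT (Star k) (λ _ → false)
Star-IsOCT-∅ k = properColouringOutside⇒IsOCT isCentre proper
  where
  proper : ProperColouringOutside (Star k) (λ _ → false) isCentre
  proper zero    (suc _) _ _ _ = refl
  proper (suc _) zero    _ _ _ = refl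

Star-centre-InBoth : ∀ {k m₁ m₂} → m₁ < k → m₂ < k → (e : MinorEmbedding (Star k) (K m₁ m₂)) →
                     InBoth e zero
Star-centre-InBoth m₁<k m₂<k e =
    decidable-stable (meets₁? (branch e zero)) (λ miss →
      let leaf = λ i → misses₁⇒neighbour-meets₁ e {w = suc i} miss refl in
      disjointBranches-≮ e suc suc-injective inj₁ (proj₁ ∘ leaf) (proj₂ ∘ leaf) m₁<k)
  , decidable-stable (meets₂? (branch e zero)) (λ miss →
      let leaf = λ i → misses₂⇒neighbour-meets₂ e {w = suc i} miss refl in
      disjointBranches-≮ e suc suc-injective inj₂ (proj₁ ∘ leaf) (proj₂ ∘ leaf) m₂<k)

owner : Fin 3 ⊎ Fin 3 → Fin 5
owner (inj₁ zero)             = zero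
owner (inj₂ zero)             = zero
owner (inj₁ (suc zero))       = suc zero
owner (inj₁ (suc (suc zero))) = suc (suc zero)
owner (inj₂ (suc zero))       = suc (suc (suc zero))
owner (inj₂ (suc (suc zero))) = suc (suc (suc (suc zero)))

Star₄↪K₃,₃ : MinorEmbedding (Star 4) (K 3 3)
Star₄↪K₃,₃ = contraction _≟ᶠ_ owner
  (from-yes (all? λ v → any⊎? λ u → owner u ≟ᶠ v))
  (λ v → clique⇒Connected λ x y x∈v y∈v →
     fibres-cliques x y (trans (∈-fibre⇒owner _≟ᶠ_ owner x∈v) (≡.sym (∈-fibre⇒owner _≟ᶠ_ owner y∈v))))
  (from-yes (all? λ v → all? λ w → (starAdj v w ≟ᵇ true) →-dec
     any⊎? λ u → any⊎? λ u' → owner u ≟ᶠ v ×-dec owner u' ≟ᶠ w ×-dec KAdj 3 3 u u' ≟ᵇ true))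
  where
  fibres-cliques : ∀ x y → owner x ≡ owner y → x ≡ y ⊎ KAdj 3 3 x y ≡ true
  fibres-cliques = from-yes (all⊎? λ x → all⊎? λ y → (owner x ≟ᶠ owner y) →-dec
                     (≡-dec _≟ᶠ_ _≟ᶠ_ x y ⊎-dec KAdj 3 3 x y ≟ᵇ true))

proposition1 :
    (∀ (n m₁ m₂ : ℕ) (G : Graph (Fin n)) (e : MinorEmbedding G (K m₁ m₂)) →
      ∃[ T ] (IsOCT G T × (∀ v → v ∈ₛ T → InBoth e v)))
    ×
    (∃[ n ] ∃[ G ] ∃[ m₁ ] ∃[ m₂ ]
      (MinorEmbedding {Fin n} G (K m₁ m₂) ×
       (∀ (e : MinorEmbedding G (K m₁ m₂)) →
         ∃[ T ] (IsOCT G T × (∀ v → v ∈ₛ T → InBoth e v)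
                 × ∃[ v ] (InBoth e v × ¬ (v ∈ₛ T))))))
proposition1 =
    (λ n m₁ m₂ G e → spanning e , spanning-IsOCT e , spanning⊆InBoth e)
  , 5 , Star 4 , 3 , 3 , Star₄↪K₃,₃ , λ e →
      (λ _ → false) , Star-IsOCT-∅ 4 , (λ _ ()) ,
      zero , Star-centre-InBoth (n<1+n 3) (n<1+n 3) e , λ ()
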